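{- Let $G$ be a finite cyclic group of order $n\ge 2$ with generator $\gamma$, and let $D:G\times G\to G$ be the bivariate Diffie-Hellman mapping $D(\gamma^a,\gamma^b)=\gamma^{ab}$, $a,b=0,\ldots,n-1$. Then the only index pair of $D$ is $(n,n)$.
   Context: For a positive divisor $\ell$ of $n$, let $C_{\ell,0}=\{\gamma^{j\ell}: j=0,1,\ldots,n/\ell-1\}$ and $C_{\ell,i}=\gamma^i C_{\ell,0}$ for $i=0,1,\ldots,\ell-1$. For positive divisors $\ell_1,\ell_2$ of $n$, a pair $(\ell_1,\ell_2)$ is called an index pair of a mapping $f:G\times G\to G$ if there exist positive integers $r_1,r_2$ and elements $a_{k_1,k_2}\in G$ ($0\le k_1\le \ell_1-1$, $0\le k_2\le \ell_2-1$) such that $f(x,y)=a_{k_1,k_2}x^{r_1}y^{r_2}$ whenever $(x,y)\in C_{\ell_1,k_1}\times C_{\ell_2,k_2}$. -}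

module Defs where

open import Level using (Level; _⊔_)
open import Algebra.Bundles using (Group)
open import Data.Nat using (ℕ; zero; suc; _*_; _+_; _<_)
open import Data.Nat.Divisibility using (_∣_)
open import Data.Fin using (Fin; toℕ)
open import Data.Product using (Σ; ∃; ∃-syntax; _×_; _,_)
open import Relation.Binary.PropositionalEquality using (_≡_)

module _ {c ℓ : Level} (G : Group c ℓ) where
  open Group G

  pow : Carrier → ℕ → Carrier
  pow x zero    = ε
  pow x (suc k) = x ∙ pow x k

  IsCyclicOfOrder : ℕ → Carrier → Set (c ⊔ ℓ)
  IsCyclicOfOrder n γ =
    (∀ x → ∃[ a ] (a < n × x ≈ pow γ a)) ×
    (∀ a b → a < n → b < n → pow γ a ≈ pow γ b → a ≡ b)

  IsDiffieHellman : ℕ → Carrier → (Carrier → Carrier → Carrier) → Set (c ⊔ ℓ)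
  IsDiffieHellman n γ D =
    (∀ {x x' y y'} → x ≈ x' → y ≈ y' → D x y ≈ D x' y') ×
    (∀ a b → a < n → b < n → D (pow γ a) (pow γ b) ≈ pow γ (a * b))

  -- x ∈ C_{ℓ',i} = γ^i C_{ℓ',0},  C_{ℓ',0} = { γ^(j ℓ') : j = 0,…,n/ℓ' - 1 }
  -- (j ≤ n/ℓ' - 1 is written as j * ℓ' < n, equivalent since ℓ' ∣ n, ℓ' > 0)
  InCoset : ℕ → Carrier → ℕ → ℕ → Carrier → Set ℓ
  InCoset n γ ℓ' i x = ∃[ j ] (j * ℓ' < n × x ≈ pow γ i ∙ pow γ (j * ℓ'))

  IsIndexPair : ℕ → Carrier → (Carrier → Carrier → Carrier) → ℕ → ℕ → Set (c ⊔ ℓ)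
  IsIndexPair n γ f ℓ₁ ℓ₂ =
    (0 < ℓ₁ × ℓ₁ ∣ n) × (0 < ℓ₂ × ℓ₂ ∣ n) ×
    Σ ℕ λ r₁ → Σ ℕ λ r₂ → (0 < r₁ × 0 < r₂) ×
    Σ (Fin ℓ₁ → Fin ℓ₂ → Carrier) λ a →
      ∀ (k₁ : Fin ℓ₁) (k₂ : Fin ℓ₂) x y →
        InCoset n γ ℓ₁ (toℕ k₁) x → InCoset n γ ℓ₂ (toℕ k₂) y →
        f x y ≈ (a k₁ k₂ ∙ pow x r₁) ∙ pow y r₂

{-# OPTIONS --safe #-}
module Submission where

-- Each C_{n,i} is the single point γ^i, so D is of index form on it with r₁ = r₂ = 1.
-- Conversely, if (ℓ₁, ℓ₂) is an index pair with ℓ₁ < n, then ε and γ^ℓ₁ both lie in C_{ℓ₁,0}.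
-- Since D(ε, ε) = ε = D(γ^ℓ₁, ε), cancelling in the index form shows that ε^r₁ = (γ^ℓ₁)^r₁,
-- and then γ^ℓ₁ = D(γ^ℓ₁, γ) = D(ε, γ) = ε, contradicting that γ has order n.
-- Since G is abelian, swapping the arguments of D turns an index pair (ℓ₁, ℓ₂) into (ℓ₂, ℓ₁).

open import Defs
open import Level using (Level)
open import Algebra.Bundles using (Group)
open import Algebra.Definitions using (Commutative)
import Algebra.Properties.Group as GroupProperties
open import Data.Fin as Fin using (Fin; toℕ)
open import Data.Fin.Properties using (toℕ<n; toℕ-fromℕ<)
open import Data.Nat using (ℕ; zero; suc; _+_; _*_; _≤_; _<_; z<s; NonZero; >-nonZero)
open import Data.Nat.DivMod using (_%_; _/_; _mod_; m%n<n; m≡m%n+[m/n]*n; m/n*n≤m)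
open import Data.Nat.Divisibility using (∣⇒≤; ∣-refl)
open import Data.Nat.Properties
  using (+-comm; <-trans; *-comm; *-zeroʳ; *-identityʳ; *-identityˡ; ≤-<-trans; ≤⇒≯; m≤m+n; m≤n⇒m<n∨m≡n; n>0⇒n≢0)
open import Data.Product using (_×_; _,_; proj₂; swap)
open import Data.Sum using (inj₁; inj₂)
open import Function using (flip)
open import Relation.Nullary using (contradiction)
open import Relation.Binary.PropositionalEquality as ≡ using (_≡_)
import Relation.Binary.Reasoning.Setoid as SetoidReasoning

module _ {c ℓ : Level} (G : Group c ℓ) where
  open Group G
  open GroupProperties G using (∙-cancelˡ; ∙-cancelʳ)

  pow-+ : ∀ x a b → pow G x (a + b) ≈ pow G x a ∙ pow G x b
  pow-+ x zero    b = sym (identityˡ _)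
  pow-+ x (suc a) b = trans (∙-congˡ (pow-+ x a b)) (sym (assoc _ _ _))

  ∙-middle-cancel : ∀ {a b x x′ y z} → (a ∙ x) ∙ y ≈ (a ∙ x′) ∙ y → (b ∙ x) ∙ z ≈ (b ∙ x′) ∙ z
  ∙-middle-cancel {a} {y = y} eq = ∙-congʳ (∙-congˡ (∙-cancelˡ a _ _ (∙-cancelʳ y _ _ eq)))

  cyclic⇒commutative : ∀ {n γ} → IsCyclicOfOrder G n γ → Commutative _≈_ _∙_
  cyclic⇒commutative {γ = γ} (generated , _) x y
    with generated x | generated y
  ... | a , _ , x≈γᵃ | b , _ , y≈γᵇ = begin
    x ∙ y                   ≈⟨ ∙-cong x≈γᵃ y≈γᵇ ⟩
    pow G γ a ∙ pow G γ b   ≈⟨ pow-+ γ a b ⟨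
    pow G γ (a + b)         ≡⟨ ≡.cong (pow G γ) (+-comm a b) ⟩
    pow G γ (b + a)         ≈⟨ pow-+ γ b a ⟩
    pow G γ b ∙ pow G γ a   ≈⟨ ∙-cong y≈γᵇ x≈γᵃ ⟨
    y ∙ x                   ∎
    where open SetoidReasoning setoid

  isDiffieHellman-flip : ∀ {n γ D} → IsDiffieHellman G n γ D → IsDiffieHellman G n γ (flip D)
  isDiffieHellman-flip {γ = γ} (D-cong , D-pow) =
    (λ x≈x′ y≈y′ → D-cong y≈y′ x≈x′) ,
    (λ a b a<n b<n → trans (D-pow b a b<n a<n) (reflexive (≡.cong (pow G γ) (*-comm b a))))

  isIndexPair-flip : ∀ {n γ f ℓ₁ ℓ₂} → Commutative _≈_ _∙_ →
                     IsIndexPair G n γ f ℓ₁ ℓ₂ → IsIndexPair G n γ (flip f) ℓ₂ ℓ₁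
  isIndexPair-flip {f = f} comm (ℓ₁-ok , ℓ₂-ok , r₁ , r₂ , r-pos , a , f≈) =
    ℓ₂-ok , ℓ₁-ok , r₂ , r₁ , swap r-pos , flip a ,
    λ k₂ k₁ y x y∈ x∈ → begin
      f x y                                   ≈⟨ f≈ k₁ k₂ x y x∈ y∈ ⟩
      (a k₁ k₂ ∙ pow G x r₁) ∙ pow G y r₂     ≈⟨ assoc _ _ _ ⟩
      a k₁ k₂ ∙ (pow G x r₁ ∙ pow G y r₂)     ≈⟨ ∙-congˡ (comm _ _) ⟩
      a k₁ k₂ ∙ (pow G y r₂ ∙ pow G x r₁)     ≈⟨ assoc _ _ _ ⟨
      (a k₁ k₂ ∙ pow G y r₂) ∙ pow G x r₁     ∎
    where open SetoidReasoning setoid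

  module Cosets (n : ℕ) (γ : Carrier) where

    pow∈InCoset : ∀ ℓ′ i j → j * ℓ′ < n → InCoset G n γ ℓ′ i (pow G γ (i + j * ℓ′))
    pow∈InCoset ℓ′ i j j*ℓ′<n = j , j*ℓ′<n , pow-+ γ i (j * ℓ′)

    pow∈InCoset-mod : ∀ ℓ′ .{{_ : NonZero ℓ′}} b → b < n →
                      InCoset G n γ ℓ′ (toℕ (b mod ℓ′)) (pow G γ b)
    pow∈InCoset-mod ℓ′ b b<n =
      ≡.subst₂ (λ i x → InCoset G n γ ℓ′ i (pow G γ x))
        (≡.sym (toℕ-fromℕ< (m%n<n b ℓ′))) (≡.sym (m≡m%n+[m/n]*n b ℓ′))
        (pow∈InCoset ℓ′ (b % ℓ′) (b / ℓ′) (≤-<-trans (m/n*n≤m b ℓ′) b<n))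

    InCoset-n⇒≈pow : ∀ i {x} → InCoset G n γ n i x → x ≈ pow G γ i
    InCoset-n⇒≈pow _ (zero  , _    , x≈) = trans x≈ (identityʳ _)
    InCoset-n⇒≈pow _ (suc j , n+jn<n , _) = contradiction n+jn<n (≤⇒≯ (m≤m+n n (j * n)))

  module DiffieHellman {n : ℕ} {γ : Carrier} (1<n : 1 < n) (cyclic : IsCyclicOfOrder G n γ) where
    open Cosets n γ
    open SetoidReasoning setoid

    0<n : 0 < n
    0<n = <-trans z<s 1<n

    instance
      n≢0 : NonZero n
      n≢0 = >-nonZero 0<n

    isIndexPair-n-n : ∀ {D} → IsDiffieHellman G n γ D → IsIndexPair G n γ D n n
    isIndexPair-n-n {D} (D-cong , D-pow) =
      (0<n , ∣-refl) , (0<n , ∣-refl) , 1 , 1 , (z<s , z<s) , a , D≈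
      where
      a : Fin n → Fin n → Carrier
      a k₁ k₂ = pow G γ (toℕ k₁ * toℕ k₂) ∙ (pow G γ (toℕ k₁) ∙ pow G γ (toℕ k₂)) ⁻¹

      D≈ : ∀ k₁ k₂ x y → InCoset G n γ n (toℕ k₁) x → InCoset G n γ n (toℕ k₂) y →
           D x y ≈ (a k₁ k₂ ∙ pow G x 1) ∙ pow G y 1
      D≈ k₁ k₂ x y x∈ y∈ = begin
        D x y                       ≈⟨ D-cong x≈u y≈v ⟩
        D u v                       ≈⟨ D-pow (toℕ k₁) (toℕ k₂) (toℕ<n k₁) (toℕ<n k₂) ⟩
        p                           ≈⟨ identityʳ p ⟨
        p ∙ ε                       ≈⟨ ∙-congˡ (inverseˡ (u ∙ v)) ⟨
        p ∙ ((u ∙ v) ⁻¹ ∙ (u ∙ v))  ≈⟨ assoc _ _ _ ⟨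
        a k₁ k₂ ∙ (u ∙ v)           ≈⟨ assoc _ _ _ ⟨
        (a k₁ k₂ ∙ u) ∙ v           ≈⟨ ∙-cong (∙-congˡ (trans (identityʳ x) x≈u)) (trans (identityʳ y) y≈v) ⟨
        (a k₁ k₂ ∙ pow G x 1) ∙ pow G y 1 ∎
        where
        p = pow G γ (toℕ k₁ * toℕ k₂)
        u = pow G γ (toℕ k₁)
        v = pow G γ (toℕ k₂)
        x≈u = InCoset-n⇒≈pow (toℕ k₁) x∈
        y≈v = InCoset-n⇒≈pow (toℕ k₂) y∈

    pow-fst-index≈ε : ∀ {D ℓ₁ ℓ₂} → IsDiffieHellman G n γ D → IsIndexPair G n γ D ℓ₁ ℓ₂ →
                      ℓ₁ < n → pow G γ ℓ₁ ≈ ε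
    pow-fst-index≈ε {ℓ₁ = ℓ₁@(suc _)} {ℓ₂} (_ , D-pow) (_ , (0<ℓ₂ , _) , r₁ , r₂ , _ , a , D≈) ℓ₁<n = begin
      pow G γ ℓ₁                       ≡⟨ ≡.cong (pow G γ) (≡.trans (*-identityʳ _) (*-identityˡ ℓ₁)) ⟨
      pow G γ (1 * ℓ₁ * 1)             ≈⟨ value-at-pow (1 * ℓ₁) 1 1ℓ₁<n 1<n x₁∈ y₁∈ ⟩
      (a Fin.zero kγ ∙ X₁) ∙ Y₁        ≈⟨ ∙-middle-cancel same-X ⟨
      (a Fin.zero kγ ∙ X₀) ∙ Y₁        ≈⟨ value-at-pow 0 1 0<n 1<n x₀∈ y₁∈ ⟨
      ε                                ∎
      where
      instance
        ℓ₂≢0 : NonZero ℓ₂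
        ℓ₂≢0 = >-nonZero 0<ℓ₂

      1ℓ₁<n : 1 * ℓ₁ < n
      1ℓ₁<n = ≡.subst (_< n) (≡.sym (*-identityˡ ℓ₁)) ℓ₁<n

      value-at-pow : ∀ {k₂} i j → i < n → j < n →
                     InCoset G n γ ℓ₁ 0 (pow G γ i) → InCoset G n γ ℓ₂ (toℕ k₂) (pow G γ j) →
                     pow G γ (i * j) ≈ (a Fin.zero k₂ ∙ pow G (pow G γ i) r₁) ∙ pow G (pow G γ j) r₂
      value-at-pow i j i<n j<n x∈ y∈ = trans (sym (D-pow i j i<n j<n)) (D≈ Fin.zero _ _ _ x∈ y∈)

      x₀∈ = pow∈InCoset ℓ₁ 0 0 0<n
      x₁∈ = pow∈InCoset ℓ₁ 0 1 1ℓ₁<n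
      y₀∈ = pow∈InCoset-mod ℓ₂ 0 0<n
      y₁∈ = pow∈InCoset-mod ℓ₂ 1 1<n
      kε = 0 mod ℓ₂
      kγ = 1 mod ℓ₂
      X₀ = pow G (pow G γ 0) r₁
      X₁ = pow G (pow G γ (1 * ℓ₁)) r₁
      Y₀ = pow G (pow G γ 0) r₂
      Y₁ = pow G (pow G γ 1) r₂

      same-X : (a Fin.zero kε ∙ X₀) ∙ Y₀ ≈ (a Fin.zero kε ∙ X₁) ∙ Y₀
      same-X = begin
        (a Fin.zero kε ∙ X₀) ∙ Y₀   ≈⟨ value-at-pow 0 0 0<n 0<n x₀∈ y₀∈ ⟨
        pow G γ 0                   ≡⟨ ≡.cong (pow G γ) (*-zeroʳ (1 * ℓ₁)) ⟨
        pow G γ (1 * ℓ₁ * 0)        ≈⟨ value-at-pow (1 * ℓ₁) 0 1ℓ₁<n 0<n x₁∈ y₀∈ ⟩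
        (a Fin.zero kε ∙ X₁) ∙ Y₀   ∎

    fst-index≡n : ∀ {D ℓ₁ ℓ₂} → IsDiffieHellman G n γ D → IsIndexPair G n γ D ℓ₁ ℓ₂ → ℓ₁ ≡ n
    fst-index≡n isDH pair@((0<ℓ₁ , ℓ₁∣n) , _) with m≤n⇒m<n∨m≡n (∣⇒≤ ℓ₁∣n)
    ... | inj₂ ℓ₁≡n = ℓ₁≡n
    ... | inj₁ ℓ₁<n = contradiction (proj₂ cyclic _ 0 ℓ₁<n 0<n (pow-fst-index≈ε isDH pair ℓ₁<n)) (n>0⇒n≢0 0<ℓ₁)

    snd-index≡n : ∀ {D ℓ₁ ℓ₂} → IsDiffieHellman G n γ D → IsIndexPair G n γ D ℓ₁ ℓ₂ → ℓ₂ ≡ n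
    snd-index≡n isDH pair =
      fst-index≡n (isDiffieHellman-flip isDH) (isIndexPair-flip (cyclic⇒commutative cyclic) pair)

theorem3 : {c ℓ : Level} (G : Group c ℓ) (n : ℕ) (γ : Group.Carrier G)
    (D : Group.Carrier G → Group.Carrier G → Group.Carrier G) →
    2 ≤ n → IsCyclicOfOrder G n γ → IsDiffieHellman G n γ D →
    IsIndexPair G n γ D n n ×
    (∀ ℓ₁ ℓ₂ → IsIndexPair G n γ D ℓ₁ ℓ₂ → ℓ₁ ≡ n × ℓ₂ ≡ n)
theorem3 G n γ D 2≤n cyclic isDH =
  isIndexPair-n-n isDH , λ _ _ pair → fst-index≡n isDH pair , snd-index≡n isDH pair
  where open DiffieHellman G 2≤n cyclic
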